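{- Let $d\ge2$ and let $\Gamma$ be a $d$-dimensional simplicial complex on vertex set $\{v_0,v_1,\dots,v_{n-1}\}$. Write indices modulo $n$ and $\sigma_k=\{v_k,v_{k+1},\dots,v_{k+d}\}$. Assume that $\sigma_0,\dots,\sigma_{n-1}$ are $d$-dimensional facets of $\Gamma$, and that among the $(d-1)$-dimensional subfaces of these $d$-facets, each of the faces $\{v_k,v_{k+1},\dots,v_{k+d-1}\}$ ($k=0,\dots,n-1$) belongs to exactly two $d$-facets, while every other $(d-1)$-dimensional subface belongs to only one $d$-facet. Then $\Gamma$ is not partitionable.
   Context: A simplicial complex is a family of subsets of a finite set closed under taking subsets; $\dim\sigma=|\sigma|-1$; facets are inclusion-maximal faces. $\Gamma$ is partitionable if $\Gamma=\dot\bigcup_{\sigma}[\tau_\sigma,\sigma]$ (disjoint union over all facets $\sigma$), where $\tau_\sigma\subseteq\sigma$ and $[\tau_\sigma,\sigma]=\{\eta\in\Gamma:\tau_\sigma\subseteq\eta\subseteq\sigma\}$. -}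

module Defs where

open import Data.Nat using (ℕ; zero; suc; _+_; _≤_; NonZero)
open import Data.Nat.DivMod using (_mod_)
open import Data.Fin using (Fin)
open import Data.Fin.Subset using (Subset; _⊆_; ∣_∣; ⁅_⁆; _∪_; ⊥)
open import Data.Bool using (Bool; true)
open import Data.Product using (Σ; _×_; ∃; ∃-syntax)
open import Data.Sum using (_⊎_)
open import Relation.Binary.PropositionalEquality using (_≡_; _≢_)
open import Relation.Nullary using (¬_)

Family : ℕ → Set
Family n = Subset n → Bool

_∈Γ_ : {n : ℕ} → Subset n → Family n → Set
σ ∈Γ Γ = Γ σ ≡ true

IsSimplicialComplex : {n : ℕ} → Family n → Set
IsSimplicialComplex {n} Γ = (σ τ : Subset n) → τ ⊆ σ → σ ∈Γ Γ → τ ∈Γ Γ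

-- dim σ = |σ| - 1, so "dim σ = k" is "|σ| = k + 1".
-- Γ is d-dimensional: every face has dimension ≤ d and some face has dimension d.
IsDimensional : {n : ℕ} → ℕ → Family n → Set
IsDimensional {n} d Γ =
  ((σ : Subset n) → σ ∈Γ Γ → ∣ σ ∣ ≤ suc d) × (∃[ σ ] (σ ∈Γ Γ × ∣ σ ∣ ≡ suc d))

IsFacet : {n : ℕ} → Family n → Subset n → Set
IsFacet {n} Γ σ = σ ∈Γ Γ × ((τ : Subset n) → τ ∈Γ Γ → σ ⊆ τ → τ ≡ σ)

IsDFacet : {n : ℕ} → ℕ → Family n → Subset n → Set
IsDFacet d Γ σ = IsFacet Γ σ × ∣ σ ∣ ≡ suc d

InExactlyOneDFacet : {n : ℕ} → ℕ → Family n → Subset n → Set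
InExactlyOneDFacet {n} d Γ τ =
  ∃[ σ ] (IsDFacet d Γ σ × τ ⊆ σ ×
          ((σ' : Subset n) → IsDFacet d Γ σ' → τ ⊆ σ' → σ' ≡ σ))

InExactlyTwoDFacets : {n : ℕ} → ℕ → Family n → Subset n → Set
InExactlyTwoDFacets {n} d Γ τ =
  ∃[ σ₁ ] ∃[ σ₂ ] (σ₁ ≢ σ₂ × IsDFacet d Γ σ₁ × τ ⊆ σ₁ × IsDFacet d Γ σ₂ × τ ⊆ σ₂ ×
          ((σ' : Subset n) → IsDFacet d Γ σ' → τ ⊆ σ' → (σ' ≡ σ₁ ⊎ σ' ≡ σ₂)))

-- arc n k m = { v_k, v_{k+1}, ..., v_{k+m-1} }  with indices modulo n.
arc : (n : ℕ) .{{_ : NonZero n}} → ℕ → ℕ → Subset n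
arc n k zero    = ⊥
arc n k (suc m) = ⁅ (k + m) mod n ⁆ ∪ arc n k m

-- Γ is partitionable: there is a choice τ_σ ⊆ σ for every facet σ such that
-- every face η of Γ lies in [τ_σ, σ] for exactly one facet σ
-- (the intervals cover Γ and are pairwise disjoint).
IsPartitionable : {n : ℕ} → Family n → Set
IsPartitionable {n} Γ =
  Σ (Subset n → Subset n) λ τ →
    ((σ : Subset n) → IsFacet Γ σ → τ σ ⊆ σ) ×
    ((η : Subset n) → η ∈Γ Γ → ∃[ σ ] (IsFacet Γ σ × τ σ ⊆ η × η ⊆ σ)) ×
    ((η σ σ' : Subset n) → η ∈Γ Γ →
       IsFacet Γ σ → τ σ ⊆ η → η ⊆ σ →
       IsFacet Γ σ' → τ σ' ⊆ η → η ⊆ σ' → σ ≡ σ')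

module Submission where

-- Let τ be the restriction map of a partition and σ_k = {v_k, …, v_{k+d}}.  A ridge
-- σ_k ∖ {v_{k+i}} with 0 < i < d is not an arc, so σ_k is its only d-facet and the ridge lies
-- in the interval of σ_k: thus τ(σ_k) ⊆ {v_k, v_{k+d}}.  The ridge σ_k ∩ σ_{k+1} lies in the
-- interval of σ_k or of σ_{k+1}, so v_{k+1+d} ∈ τ(σ_{k+1}) excludes v_k ∈ τ(σ_k).  As the vertex
-- v_{k+d} lies in a single interval, τ(σ_k) and τ(σ_{k+d}) are not both inside {v_{k+d}}; hence
-- v_{k+d-1} ∈ τ(σ_{k+d-1}) forces v_k ∈ τ(σ_k), and going round the cycle in steps of d - 1,
-- v_{j+d} ∈ τ(σ_j) and v_{j-d} ∈ τ(σ_{j-d}) exclude each other.  Finally let F be the facet whose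
-- interval contains ∅, so τ F = ∅.  For a vertex v_j of F, the interval of {v_j} forces both
-- memberships unless F = σ_j or F = σ_{j-d}; and F = σ_a is excluded by taking j = a + 1.

open import Defs
open import Data.Bool using (true; false)
open import Data.Empty using (⊥-elim)
open import Data.Fin as Fin using (Fin; toℕ)
open import Data.Fin.Properties using (toℕ-fromℕ<; toℕ-injective; toℕ<n)
open import Data.Fin.Subset
open import Data.Fin.Subset.Properties
open import Data.Nat
  using (ℕ; zero; suc; _+_; _*_; _∸_; _≤_; _<_; _≟_; z≤n; s≤s; z<s; s≤s⁻¹; NonZero; _%_; _/_)
open import Data.Nat.DivMod
open import Data.Nat.Properties hiding (_≟_)
open import Data.Nat.Tactic.RingSolver using (solve-∀)
open import Data.Product using (∃; ∃-syntax; _×_; _,_; proj₁; proj₂)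
open import Data.Sum using (_⊎_; inj₁; inj₂; [_,_]′)
open import Data.Vec using ([]; _∷_; here; there)
open import Function using (_∘_)
open import Relation.Binary.PropositionalEquality
open import Relation.Nullary using (¬_; yes; no; contradiction)
open import Relation.Nullary.Decidable using (decidable-stable)

∣p∪q∣≤∣p∣+∣q∣ : ∀ {n} (p q : Subset n) → ∣ p ∪ q ∣ ≤ ∣ p ∣ + ∣ q ∣
∣p∪q∣≤∣p∣+∣q∣ []          []          = z≤n
∣p∪q∣≤∣p∣+∣q∣ (true  ∷ p) (true  ∷ q) = s≤s (≤-trans (∣p∪q∣≤∣p∣+∣q∣ p q) (+-monoʳ-≤ ∣ p ∣ (n≤1+n ∣ q ∣)))
∣p∪q∣≤∣p∣+∣q∣ (true  ∷ p) (false ∷ q) = s≤s (∣p∪q∣≤∣p∣+∣q∣ p q)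
∣p∪q∣≤∣p∣+∣q∣ (false ∷ p) (true  ∷ q) =
  subst (suc ∣ p ∪ q ∣ ≤_) (sym (+-suc ∣ p ∣ ∣ q ∣)) (s≤s (∣p∪q∣≤∣p∣+∣q∣ p q))
∣p∪q∣≤∣p∣+∣q∣ (false ∷ p) (false ∷ q) = ∣p∪q∣≤∣p∣+∣q∣ p q

∣⁅x⁆∪p∣≤1+∣p∣ : ∀ {n} (x : Fin n) (p : Subset n) → ∣ ⁅ x ⁆ ∪ p ∣ ≤ suc ∣ p ∣
∣⁅x⁆∪p∣≤1+∣p∣ x p = subst (λ k → ∣ ⁅ x ⁆ ∪ p ∣ ≤ k + ∣ p ∣) (∣⁅x⁆∣≡1 x) (∣p∪q∣≤∣p∣+∣q∣ ⁅ x ⁆ p)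

∣p∣≤1+∣p-x∣ : ∀ {n} (p : Subset n) (x : Fin n) → ∣ p ∣ ≤ suc ∣ p - x ∣
∣p∣≤1+∣p-x∣ p x = ≤-trans (p⊆q⇒∣p∣≤∣q∣ p⊆⁅x⁆∪p-x) (∣⁅x⁆∪p∣≤1+∣p∣ x (p - x))
  where
  p⊆⁅x⁆∪p-x : p ⊆ ⁅ x ⁆ ∪ (p - x)
  p⊆⁅x⁆∪p-x {y} y∈p with y Fin.≟ x
  ... | yes refl = x∈p∪q⁺ (inj₁ (x∈⁅x⁆ x))
  ... | no y≢x   = x∈p∪q⁺ (inj₂ (x∈p∧x≢y⇒x∈p-y y∈p y≢x))

x∉p-x : ∀ {n} (p : Subset n) (x : Fin n) → x ∉ p - x
x∉p-x (_ ∷ p) Fin.zero    ()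
x∉p-x (_ ∷ p) (Fin.suc x) (there x∈p-x) = x∉p-x p x x∈p-x

x∈p⇒⁅x⁆⊆p : ∀ {n} {x : Fin n} {p : Subset n} → x ∈ p → ⁅ x ⁆ ⊆ p
x∈p⇒⁅x⁆⊆p x∈p y∈⁅x⁆ = subst (_∈ _) (sym (x∈⁅y⁆⇒x≡y _ y∈⁅x⁆)) x∈p

p⊆q∧∣q∣≤∣p∣⇒p≡q : ∀ {n} {p q : Subset n} → p ⊆ q → ∣ q ∣ ≤ ∣ p ∣ → p ≡ q
p⊆q∧∣q∣≤∣p∣⇒p≡q {p = []}        {[]}        _   _   = refl
p⊆q∧∣q∣≤∣p∣⇒p≡q {p = false ∷ p} {false ∷ q} p⊆q q≤p =
  cong (false ∷_) (p⊆q∧∣q∣≤∣p∣⇒p≡q (drop-∷-⊆ p⊆q) q≤p)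
p⊆q∧∣q∣≤∣p∣⇒p≡q {p = false ∷ p} {true  ∷ q} p⊆q q≤p =
  contradiction (≤-trans q≤p (p⊆q⇒∣p∣≤∣q∣ (drop-∷-⊆ p⊆q))) (<⇒≱ ≤-refl)
p⊆q∧∣q∣≤∣p∣⇒p≡q {p = true  ∷ p} {false ∷ q} p⊆q _   = contradiction (p⊆q here) λ ()
p⊆q∧∣q∣≤∣p∣⇒p≡q {p = true  ∷ p} {true  ∷ q} p⊆q q≤p =
  cong (true ∷_) (p⊆q∧∣q∣≤∣p∣⇒p≡q (drop-∷-⊆ p⊆q) (s≤s⁻¹ q≤p))

%-cong-+ʳ : ∀ {x y} z {n} .{{_ : NonZero n}} → x % n ≡ y % n → (x + z) % n ≡ (y + z) % n
%-cong-+ʳ {x} {y} z {n} eq = begin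
  (x + z) % n           ≡⟨ %-distribˡ-+ x z n ⟩
  (x % n + z % n) % n   ≡⟨ cong (λ r → (r + z % n) % n) eq ⟩
  (y % n + z % n) % n   ≡⟨ %-distribˡ-+ y z n ⟨
  (y + z) % n           ∎
  where open ≡-Reasoning

%-cong-+ˡ : ∀ {x y} z {n} .{{_ : NonZero n}} → x % n ≡ y % n → (z + x) % n ≡ (z + y) % n
%-cong-+ˡ {x} {y} z eq = subst₂ (λ l r → l % _ ≡ r % _) (+-comm x z) (+-comm y z) (%-cong-+ʳ z eq)

%-cancelˡ-+ : ∀ a {x y n} .{{_ : NonZero n}} → (a + x) % n ≡ (a + y) % n → x % n ≡ y % n
%-cancelˡ-+ a {x} {y} {n@(suc n-1)} eq = begin
  x % n                 ≡⟨ [m+kn]%n≡m%n x a n ⟨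
  (x + a * n) % n       ≡⟨ cong (_% n) (shift x a n-1) ⟩
  (a + x + a * n-1) % n ≡⟨ %-cong-+ʳ {a + x} {a + y} (a * n-1) eq ⟩
  (a + y + a * n-1) % n ≡⟨ cong (_% n) (shift y a n-1) ⟨
  (y + a * n) % n       ≡⟨ [m+kn]%n≡m%n y a n ⟩
  y % n                 ∎
  where
  open ≡-Reasoning
  shift : ∀ z a m → z + a * suc m ≡ a + z + a * m
  shift = solve-∀

%-cancelʳ-+ : ∀ {x y} a {n} .{{_ : NonZero n}} → (x + a) % n ≡ (y + a) % n → x % n ≡ y % n
%-cancelʳ-+ {x} {y} a eq = %-cancelˡ-+ a (subst₂ (λ l r → l % _ ≡ r % _) (+-comm x a) (+-comm y a) eq)

[p+d]%n≡q⇒2+q≤p : ∀ {p q d n} .{{_ : NonZero n}} → q < d → suc d < n → (p + d) % n ≡ q → suc (suc q) ≤ p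
[p+d]%n≡q⇒2+q≤p {p} {q} {d} {n} q<d 1+d<n eq with (p + d) / n | m≡m%n+[m/n]*n (p + d) n
... | zero  | p+d≡q+0 =
  contradiction (≤-trans (m≤n+m d p) (≤-reflexive (trans p+d≡q+0 (trans (cong (_+ 0) eq) (+-identityʳ q)))))
                (<⇒≱ q<d)
... | suc t | p+d≡q+[1+t]n = +-cancelʳ-≤ d (suc (suc q)) p (begin
  suc (suc q) + d         ≡⟨ cong suc (+-suc q d) ⟨
  suc q + suc d           ≡⟨ +-suc q (suc d) ⟨
  q + suc (suc d)         ≤⟨ +-monoʳ-≤ q (≤-trans 1+d<n (m≤m+n n (t * n))) ⟩
  q + suc t * n           ≡⟨ cong (_+ suc t * n) eq ⟨
  (p + d) % n + suc t * n ≡⟨ p+d≡q+[1+t]n ⟨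
  p + d                   ∎)
  where open ≤-Reasoning

module CyclicArcs (n : ℕ) .{{_ : NonZero n}} where

  v : ℕ → Fin n
  v k = k mod n

  toℕ-v : ∀ k → toℕ (v k) ≡ k % n
  toℕ-v k = toℕ-fromℕ< (m%n<n k n)

  v-cong : ∀ {k l} → k % n ≡ l % n → v k ≡ v l
  v-cong {k} {l} eq = toℕ-injective (trans (toℕ-v k) (trans eq (sym (toℕ-v l))))

  v≡v⇒%≡% : ∀ {k l} → v k ≡ v l → k % n ≡ l % n
  v≡v⇒%≡% {k} {l} eq = trans (sym (toℕ-v k)) (trans (cong toℕ eq) (toℕ-v l))

  v-toℕ : (x : Fin n) → v (toℕ x) ≡ x
  v-toℕ x = toℕ-injective (trans (toℕ-v (toℕ x)) (m<n⇒m%n≡m (toℕ<n x)))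

  v-injective-< : ∀ a {i j} → i < n → j < n → v (a + i) ≡ v (a + j) → i ≡ j
  v-injective-< a {i} {j} i<n j<n eq = begin
    i       ≡⟨ m<n⇒m%n≡m i<n ⟨
    i % n   ≡⟨ %-cancelˡ-+ a (v≡v⇒%≡% eq) ⟩
    j % n   ≡⟨ m<n⇒m%n≡m j<n ⟩
    j       ∎
    where open ≡-Reasoning

  ∈-arc⁻ : ∀ k m {y} → y ∈ arc n k m → ∃ λ i → i < m × y ≡ v (k + i)
  ∈-arc⁻ k zero    y∈arc = ⊥-elim (∉⊥ y∈arc)
  ∈-arc⁻ k (suc m) y∈arc with x∈p∪q⁻ ⁅ v (k + m) ⁆ (arc n k m) y∈arc
  ... | inj₁ y∈⁅v⁆ = m , ≤-refl , x∈⁅y⁆⇒x≡y _ y∈⁅v⁆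
  ... | inj₂ y∈arc′ with i , i<m , y≡v ← ∈-arc⁻ k m y∈arc′ = i , m<n⇒m<1+n i<m , y≡v

  ∈-arc⁺ : ∀ k m {i} → i < m → v (k + i) ∈ arc n k m
  ∈-arc⁺ k (suc m) {i} i<1+m with i ≟ m
  ... | yes refl = x∈p∪q⁺ (inj₁ (x∈⁅x⁆ _))
  ... | no i≢m   = x∈p∪q⁺ (inj₂ (∈-arc⁺ k m (≤∧≢⇒< (s≤s⁻¹ i<1+m) i≢m)))

  ∉-arc : ∀ k m {i} → m ≤ i → i < n → v (k + i) ∉ arc n k m
  ∉-arc k m m≤i i<n v∈arc with j , j<m , v≡v ← ∈-arc⁻ k m v∈arc =
    <⇒≱ j<m (subst (m ≤_) (v-injective-< k i<n (<-≤-trans j<m (≤-trans m≤i (<⇒≤ i<n))) v≡v) m≤i)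

  arc-cong : ∀ {k l} m → k % n ≡ l % n → arc n k m ≡ arc n l m
  arc-cong zero    eq = refl
  arc-cong (suc m) eq = cong₂ (λ x p → ⁅ x ⁆ ∪ p) (v-cong (%-cong-+ʳ m eq)) (arc-cong m eq)

  ∣arc∣≤ : ∀ k m → ∣ arc n k m ∣ ≤ m
  ∣arc∣≤ k zero    = ≤-reflexive (∣⊥∣≡0 n)
  ∣arc∣≤ k (suc m) = ≤-trans (∣⁅x⁆∪p∣≤1+∣p∣ (v (k + m)) (arc n k m)) (s≤s (∣arc∣≤ k m))

  ∣arc[1+m]∣≡1+m⇒∣arc[m]∣≡m : ∀ k m → ∣ arc n k (suc m) ∣ ≡ suc m → ∣ arc n k m ∣ ≡ m
  ∣arc[1+m]∣≡1+m⇒∣arc[m]∣≡m k m eq = ≤-antisym (∣arc∣≤ k m)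
    (s≤s⁻¹ (subst (_≤ suc ∣ arc n k m ∣) eq (∣⁅x⁆∪p∣≤1+∣p∣ (v (k + m)) (arc n k m))))

  wrap-around : ∀ {k j m} → suc m < n → v k ∈ arc n j m → v (k + m) ∈ arc n j m →
                v (k + suc m) ∈ arc n j m
  wrap-around {k} {j} {m} 1+m<n v[k]∈arc v[k+m]∈arc
    with p , p<m , v[k]≡v[j+p] ← ∈-arc⁻ j m v[k]∈arc
       | q , q<m , v[k+m]≡v[j+q] ← ∈-arc⁻ j m v[k+m]∈arc =
    subst (_∈ arc n j m) v[j+1+q]≡v[k+1+m] (∈-arc⁺ j m (<-≤-trans 2+q≤p (<⇒≤ p<m)))
    where
    [p+m]%n≡q : (p + m) % n ≡ q
    [p+m]%n≡q = trans (%-cancelˡ-+ j (begin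
      (j + (p + m)) % n ≡⟨ cong (_% n) (+-assoc j p m) ⟨
      (j + p + m) % n   ≡⟨ %-cong-+ʳ m (v≡v⇒%≡% v[k]≡v[j+p]) ⟨
      (k + m) % n       ≡⟨ v≡v⇒%≡% v[k+m]≡v[j+q] ⟩
      (j + q) % n       ∎)) (m<n⇒m%n≡m (<-trans q<m (<-trans (n<1+n m) 1+m<n)))
      where open ≡-Reasoning
    2+q≤p : suc (suc q) ≤ p
    2+q≤p = [p+d]%n≡q⇒2+q≤p q<m 1+m<n [p+m]%n≡q
    v[j+1+q]≡v[k+1+m] : v (j + suc q) ≡ v (k + suc m)
    v[j+1+q]≡v[k+1+m] = v-cong (subst₂ (λ l r → l % n ≡ r % n) (sym (+-suc j q)) (sym (+-suc k m))
      (%-cong-+ˡ 1 (sym (v≡v⇒%≡% v[k+m]≡v[j+q]))))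

  arc-minus-inner-≢-arc : ∀ k {m i} → suc m < n → 0 < i → i < m →
                          ∀ j → arc n k (suc m) - v (k + i) ≢ arc n j m
  arc-minus-inner-≢-arc k {m} {i} 1+m<n 0<i i<m j η≡arc = ∉-arc k (suc m) ≤-refl 1+m<n
    (p─q⊆p _ _ (subst (v (k + suc m) ∈_) (sym η≡arc) (wrap-around 1+m<n v[k]∈arc v[k+m]∈arc)))
    where
    m<n : m < n
    m<n = <-trans (n<1+n m) 1+m<n
    kept : ∀ {l} → l ≤ m → l ≢ i → v (k + l) ∈ arc n j m
    kept l≤m l≢i = subst (v (k + _) ∈_) η≡arc (x∈p∧x≢y⇒x∈p-y (∈-arc⁺ k (suc m) (s≤s l≤m))
      (l≢i ∘ v-injective-< k (≤-<-trans l≤m m<n) (<-trans i<m m<n)))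
    v[k]∈arc : v k ∈ arc n j m
    v[k]∈arc = subst (λ l → v l ∈ arc n j m) (+-identityʳ k) (kept z≤n (<⇒≢ 0<i))
    v[k+m]∈arc : v (k + m) ∈ arc n j m
    v[k+m]∈arc = kept ≤-refl (≢-sym (<⇒≢ i<m))

module _ {n d : ℕ} {Γ : Family n} where

  exactly-one-unique : ∀ {η σ σ′} → InExactlyOneDFacet d Γ η →
    IsDFacet d Γ σ → η ⊆ σ → IsDFacet d Γ σ′ → η ⊆ σ′ → σ ≡ σ′
  exactly-one-unique (_ , _ , _ , only) dσ η⊆σ dσ′ η⊆σ′ = trans (only _ dσ η⊆σ) (sym (only _ dσ′ η⊆σ′))

  exactly-two-cases : ∀ {η σ₁ σ₂ σ} → InExactlyTwoDFacets d Γ η → σ₁ ≢ σ₂ →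
    IsDFacet d Γ σ₁ → η ⊆ σ₁ → IsDFacet d Γ σ₂ → η ⊆ σ₂ → IsDFacet d Γ σ → η ⊆ σ → σ ≡ σ₁ ⊎ σ ≡ σ₂
  exactly-two-cases (_ , _ , _ , _ , _ , _ , _ , only) σ₁≢σ₂ d₁ η⊆σ₁ d₂ η⊆σ₂ dσ η⊆σ
    with only _ d₁ η⊆σ₁ | only _ d₂ η⊆σ₂ | only _ dσ η⊆σ
  ... | inj₁ p | inj₁ q | _      = contradiction (trans p (sym q)) σ₁≢σ₂
  ... | inj₂ p | inj₂ q | _      = contradiction (trans p (sym q)) σ₁≢σ₂
  ... | inj₁ p | inj₂ q | inj₁ r = inj₁ (trans r (sym p))
  ... | inj₁ p | inj₂ q | inj₂ r = inj₂ (trans r (sym q))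
  ... | inj₂ p | inj₁ q | inj₁ r = inj₂ (trans r (sym q))
  ... | inj₂ p | inj₁ q | inj₂ r = inj₁ (trans r (sym p))

  exactly-two⇒1+d≢n : ∀ {η} → InExactlyTwoDFacets d Γ η → suc d ≢ n
  exactly-two⇒1+d≢n (_ , _ , σ₁≢σ₂ , (_ , ∣σ₁∣≡1+d) , _ , (_ , ∣σ₂∣≡1+d) , _) 1+d≡n =
    σ₁≢σ₂ (trans (∣p∣≡n⇒p≡⊤ (trans ∣σ₁∣≡1+d 1+d≡n)) (sym (∣p∣≡n⇒p≡⊤ (trans ∣σ₂∣≡1+d 1+d≡n))))

facet-⊇-proper-face : ∀ {n} {Γ : Family n} {F η S : Subset n} →
  IsFacet Γ F → η ⊆ F → S ∈Γ Γ → η ⊂ S → ∣ η ∣ < ∣ F ∣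
facet-⊇-proper-face {F = F} {η} {S} (_ , maximal) η⊆F S∈Γ (η⊆S , x , x∈S , x∉η) =
  ≰⇒> λ ∣F∣≤∣η∣ → x∉η (subst (x ∈_) (sym (η≡S ∣F∣≤∣η∣)) x∈S)
  where
  η≡S : ∣ F ∣ ≤ ∣ η ∣ → η ≡ S
  η≡S ∣F∣≤∣η∣ with η≡F ← p⊆q∧∣q∣≤∣p∣⇒p≡q η⊆F ∣F∣≤∣η∣ =
    trans η≡F (sym (maximal S S∈Γ (subst (_⊆ S) η≡F η⊆S)))

module Partition {n} {Γ : Family n} (cx : IsSimplicialComplex Γ) (P : IsPartitionable Γ) where

  τ : Subset n → Subset n
  τ = proj₁ P

  τσ⊆σ : ∀ {σ} → IsFacet Γ σ → τ σ ⊆ σ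
  τσ⊆σ = proj₁ (proj₂ P) _

  interval : ∀ η → η ∈Γ Γ → ∃[ σ ] (IsFacet Γ σ × τ σ ⊆ η × η ⊆ σ)
  interval = proj₁ (proj₂ (proj₂ P))

  interval-unique : ∀ {η σ σ′} → η ∈Γ Γ → IsFacet Γ σ → τ σ ⊆ η → η ⊆ σ →
                    IsFacet Γ σ′ → τ σ′ ⊆ η → η ⊆ σ′ → σ ≡ σ′
  interval-unique = proj₂ (proj₂ (proj₂ P)) _ _ _

  τ⊆⁅x⁆-unique : ∀ {σ σ′ x} → IsFacet Γ σ → IsFacet Γ σ′ → x ∈ σ → x ∈ σ′ →
                 τ σ ⊆ ⁅ x ⁆ → τ σ′ ⊆ ⁅ x ⁆ → σ ≡ σ′
  τ⊆⁅x⁆-unique fσ fσ′ x∈σ x∈σ′ τσ⊆⁅x⁆ τσ′⊆⁅x⁆ =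
    interval-unique (cx _ _ (x∈p⇒⁅x⁆⊆p x∈σ) (proj₁ fσ))
      fσ τσ⊆⁅x⁆ (x∈p⇒⁅x⁆⊆p x∈σ) fσ′ τσ′⊆⁅x⁆ (x∈p⇒⁅x⁆⊆p x∈σ′)

  module _ {d : ℕ} (dim : ∀ σ → σ ∈Γ Γ → ∣ σ ∣ ≤ suc d) where

    interval-of-ridge : ∀ {η S} → S ∈Γ Γ → η ⊂ S → ∣ η ∣ ≡ d →
                        ∃[ F ] (IsDFacet d Γ F × τ F ⊆ η × η ⊆ F)
    interval-of-ridge S∈Γ η⊂S ∣η∣≡d with F , fF , τF⊆η , η⊆F ← interval _ (cx _ _ (proj₁ η⊂S) S∈Γ) =
      F , (fF , ≤-antisym (dim F (proj₁ fF)) d<∣F∣) , τF⊆η , η⊆F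
      where
      d<∣F∣ : d < ∣ F ∣
      d<∣F∣ = subst (_< ∣ F ∣) ∣η∣≡d (facet-⊇-proper-face fF η⊆F S∈Γ η⊂S)

    τ⊆ridge-of-one-facet : ∀ {η σ} → InExactlyOneDFacet d Γ η → IsDFacet d Γ σ → η ⊂ σ → ∣ η ∣ ≡ d →
                           τ σ ⊆ η
    τ⊆ridge-of-one-facet one dσ η⊂σ ∣η∣≡d
      with F , dF , τF⊆η , η⊆F ← interval-of-ridge (proj₁ (proj₁ dσ)) η⊂σ ∣η∣≡d =
      subst (λ F → τ F ⊆ _) (exactly-one-unique one dF η⊆F dσ (proj₁ η⊂σ)) τF⊆η

    τ⊆ridge-of-two-facets : ∀ {η σ₁ σ₂} → InExactlyTwoDFacets d Γ η → σ₁ ≢ σ₂ →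
      IsDFacet d Γ σ₁ → η ⊆ σ₁ → IsDFacet d Γ σ₂ → η ⊂ σ₂ → ∣ η ∣ ≡ d → τ σ₁ ⊆ η ⊎ τ σ₂ ⊆ η
    τ⊆ridge-of-two-facets two σ₁≢σ₂ d₁ η⊆σ₁ d₂ η⊂σ₂ ∣η∣≡d
      with F , dF , τF⊆η , η⊆F ← interval-of-ridge (proj₁ (proj₁ d₂)) η⊂σ₂ ∣η∣≡d
      with exactly-two-cases two σ₁≢σ₂ d₁ η⊆σ₁ d₂ (proj₁ η⊂σ₂) dF η⊆F
    ... | inj₁ F≡σ₁ = inj₁ (subst (λ F → τ F ⊆ _) F≡σ₁ τF⊆η)
    ... | inj₂ F≡σ₂ = inj₂ (subst (λ F → τ F ⊆ _) F≡σ₂ τF⊆η)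

ArcFacets : (n : ℕ) .{{_ : NonZero n}} → ℕ → Family n → Set
ArcFacets n d Γ = (k : ℕ) → IsDFacet d Γ (arc n k (suc d))

RidgeCondition : (n : ℕ) .{{_ : NonZero n}} → ℕ → Family n → Set
RidgeCondition n d Γ = (k : ℕ) (η : Subset n) → η ⊆ arc n k (suc d) → ∣ η ∣ ≡ d →
  ((∃[ j ] (η ≡ arc n j d)) → InExactlyTwoDFacets d Γ η) ×
  (¬ (∃[ j ] (η ≡ arc n j d)) → InExactlyOneDFacet d Γ η)

arc-facets⇒1+d<n : ∀ n .{{_ : NonZero n}} {d} {Γ : Family n} →
                   ArcFacets n d Γ → RidgeCondition n d Γ → suc d < n
arc-facets⇒1+d<n n {d} arc-facet ridges = ≤∧≢⇒< (subst (_≤ n) (proj₂ (arc-facet 0)) (∣p∣≤n (arc n 0 (suc d))))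
  (exactly-two⇒1+d≢n (proj₁ (ridges 0 (arc n 0 d) (x∈p∪q⁺ ∘ inj₂) ∣arc[0,d]∣≡d) (0 , refl)))
  where
  ∣arc[0,d]∣≡d : ∣ arc n 0 d ∣ ≡ d
  ∣arc[0,d]∣≡d = CyclicArcs.∣arc[1+m]∣≡1+m⇒∣arc[m]∣≡m n 0 d (proj₂ (arc-facet 0))

module CyclicComplex {n′ e : ℕ} {Γ : Family (suc n′)}
  (cx : IsSimplicialComplex Γ)
  (dim : ∀ σ → σ ∈Γ Γ → ∣ σ ∣ ≤ suc (suc e))
  (arc-facet : ArcFacets (suc n′) (suc e) Γ)
  (ridges : RidgeCondition (suc n′) (suc e) Γ)
  (0<e : 0 < e)
  (P : IsPartitionable Γ)
  where

  n d : ℕ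
  n = suc n′
  d = suc e

  open CyclicArcs n
  open Partition cx P

  1+d<n : suc d < n
  1+d<n = arc-facets⇒1+d<n n arc-facet ridges

  d<n : d < n
  d<n = <-trans (n<1+n d) 1+d<n

  σ : ℕ → Subset n
  σ k = arc n k (suc d)

  First Last : ℕ → Set
  First k = v k ∈ τ (σ k)
  Last  k = v (k + d) ∈ τ (σ k)

  σ-facet : ∀ k → IsFacet Γ (σ k)
  σ-facet k = proj₁ (arc-facet k)

  v∈σ : ∀ k {i} → i ≤ d → v (k + i) ∈ σ k
  v∈σ k i≤d = ∈-arc⁺ k (suc d) (s≤s i≤d)

  v[k]∈σ[k] : ∀ k → v k ∈ σ k
  v[k]∈σ[k] k = subst (λ i → v i ∈ σ k) (+-identityʳ k) (v∈σ k z≤n)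

  σ-distinct : ∀ a {j} → 0 < j → j ≤ suc d → σ a ≢ σ (a + j)
  σ-distinct a {j} 0<j j≤1+d σa≡σ[a+j] =
    ∉-arc a (suc d) ≤-refl 1+d<n (subst (v (a + suc d) ∈_) (sym σa≡σ[a+j]) v[a+1+d]∈σ[a+j])
    where
    v[a+1+d]∈σ[a+j] : v (a + suc d) ∈ σ (a + j)
    v[a+1+d]∈σ[a+j] = subst (λ i → v i ∈ σ (a + j))
      (trans (+-assoc a j (suc d ∸ j)) (cong (a +_) (m+[n∸m]≡n j≤1+d)))
      (v∈σ (a + j) (∸-monoʳ-≤ (suc d) 0<j))

  σ≢σ[1+] : ∀ a → σ a ≢ σ (suc a)
  σ≢σ[1+] a eq = σ-distinct a z<s (s≤s z≤n) (trans eq (cong σ (+-comm 1 a)))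

  σ-cong : ∀ {a b} → a % n ≡ b % n → σ a ≡ σ b
  σ-cong {a} {b} = arc-cong {a} {b} (suc d)

  First-cong : ∀ {a b} → a % n ≡ b % n → First a → First b
  First-cong {a} {b} eq = subst₂ (λ x σ → x ∈ τ σ) (v-cong {a} {b} eq) (σ-cong eq)

  Last-cong : ∀ {a b} → a % n ≡ b % n → Last a → Last b
  Last-cong {a} {b} eq =
    subst₂ (λ x σ → x ∈ τ σ) (v-cong {a + d} {b + d} (%-cong-+ʳ {a} {b} d eq)) (σ-cong eq)

  inner∉τσ : ∀ k {i} → 0 < i → i < d → v (k + i) ∉ τ (σ k)
  inner∉τσ k {i} 0<i i<d x∈τσ = x∉p-x (σ k) x (τσ⊆η x∈τσ)
    where
    x : Fin n
    x = v (k + i)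
    x∈σ : x ∈ σ k
    x∈σ = v∈σ k (<⇒≤ i<d)
    η⊂σ : σ k - x ⊂ σ k
    η⊂σ = x∈p⇒p-x⊂p x∈σ
    ∣η∣≡d : ∣ σ k - x ∣ ≡ d
    ∣η∣≡d = ≤-antisym
      (s≤s⁻¹ (subst (∣ σ k - x ∣ <_) (proj₂ (arc-facet k)) (x∈p⇒∣p-x∣<∣p∣ x∈σ)))
      (s≤s⁻¹ (subst (_≤ suc ∣ σ k - x ∣) (proj₂ (arc-facet k)) (∣p∣≤1+∣p-x∣ (σ k) x)))
    not-arc : ¬ (∃[ j ] (σ k - x ≡ arc n j d))
    not-arc (j , η≡arc) = arc-minus-inner-≢-arc k 1+d<n 0<i i<d j η≡arc
    τσ⊆η : τ (σ k) ⊆ σ k - x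
    τσ⊆η = τ⊆ridge-of-one-facet dim (proj₂ (ridges k (σ k - x) (proj₁ η⊂σ) ∣η∣≡d) not-arc)
      (arc-facet k) η⊂σ ∣η∣≡d

  τσ⊆ends : ∀ k {x} → x ∈ τ (σ k) → x ≡ v k ⊎ x ≡ v (k + d)
  τσ⊆ends k {x} x∈τσ with ∈-arc⁻ k (suc d) (τσ⊆σ (σ-facet k) x∈τσ)
  ... | zero  , _     , x≡v = inj₁ (trans x≡v (cong v (+-identityʳ k)))
  ... | suc i , i<1+d , x≡v with suc i ≟ d
  ...   | yes refl = inj₂ x≡v
  ...   | no i≢d   = ⊥-elim (inner∉τσ k z<s (≤∧≢⇒< (s≤s⁻¹ i<1+d) i≢d) (subst (_∈ τ (σ k)) x≡v x∈τσ))

  ¬First⇒τσ⊆⁅last⁆ : ∀ k → ¬ First k → τ (σ k) ⊆ ⁅ v (k + d) ⁆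
  ¬First⇒τσ⊆⁅last⁆ k ¬first x∈τσ with τσ⊆ends k x∈τσ
  ... | inj₁ refl = contradiction x∈τσ ¬first
  ... | inj₂ refl = x∈⁅x⁆ _

  ¬Last⇒τσ⊆⁅first⁆ : ∀ k → ¬ Last k → τ (σ k) ⊆ ⁅ v k ⁆
  ¬Last⇒τσ⊆⁅first⁆ k ¬last x∈τσ with τσ⊆ends k x∈τσ
  ... | inj₁ refl = x∈⁅x⁆ _
  ... | inj₂ refl = contradiction x∈τσ ¬last

  ridge : ∀ w → Subset n
  ridge w = arc n (suc w) d

  ridge⊆σ : ∀ w → ridge w ⊆ σ w
  ridge⊆σ w y∈ρ with i , i<d , y≡v ← ∈-arc⁻ (suc w) d y∈ρ =
      subst (_∈ σ w) (sym (trans y≡v (cong v (sym (+-suc w i))))) (v∈σ w i<d)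

  ridge⊂σ[1+] : ∀ w → ridge w ⊂ σ (suc w)
  ridge⊂σ[1+] w = (x∈p∪q⁺ ∘ inj₂) , v (suc w + d) , v∈σ (suc w) ≤-refl , ∉-arc (suc w) d ≤-refl d<n

  ∣ridge∣≡d : ∀ w → ∣ ridge w ∣ ≡ d
  ∣ridge∣≡d w = ∣arc[1+m]∣≡1+m⇒∣arc[m]∣≡m (suc w) d (proj₂ (arc-facet (suc w)))

  ridge-two : ∀ w → InExactlyTwoDFacets d Γ (ridge w)
  ridge-two w = proj₁ (ridges (suc w) (ridge w) (proj₁ (ridge⊂σ[1+] w)) (∣ridge∣≡d w)) (suc w , refl)

  τσ⊆ridge : ∀ w → τ (σ w) ⊆ ridge w ⊎ τ (σ (suc w)) ⊆ ridge w
  τσ⊆ridge w = τ⊆ridge-of-two-facets dim (ridge-two w) (σ≢σ[1+] w) (arc-facet w) (ridge⊆σ w)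
                 (arc-facet (suc w)) (ridge⊂σ[1+] w) (∣ridge∣≡d w)

  v∉ridge : ∀ w → v w ∉ ridge w
  v∉ridge w = subst (_∉ ridge w) v[w+n]≡v[w] (∉-arc (suc w) d {n′} (s≤s⁻¹ d<n) ≤-refl)
    where
    v[w+n]≡v[w] : v (suc w + n′) ≡ v w
    v[w+n]≡v[w] = v-cong {suc w + n′} {w} (trans (cong (_% n) (sym (+-suc w n′))) ([m+n]%n≡m%n w n))

  Last[1+w]⇒¬First[w] : ∀ w → Last (suc w) → ¬ First w
  Last[1+w]⇒¬First[w] w last first =
    [ (λ τσ⊆ρ → v∉ridge w (τσ⊆ρ first)) , (λ τσ[1+w]⊆ρ → ∉-arc (suc w) d {d} ≤-refl d<n (τσ[1+w]⊆ρ last)) ]′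
    (τσ⊆ridge w)

  First[w+e]⇒First[w] : ∀ w → First (w + e) → First w
  First[w+e]⇒First[w] w first = decidable-stable (v w ∈? τ (σ w)) λ ¬first →
    σ-distinct w z<s (n≤1+n d)
      (τ⊆⁅x⁆-unique (σ-facet w) (σ-facet (w + d)) (v∈σ w ≤-refl) (v[k]∈σ[k] (w + d))
        (¬First⇒τσ⊆⁅last⁆ w ¬first) (¬Last⇒τσ⊆⁅first⁆ (w + d) ¬last))
    where
    ¬last : ¬ Last (w + d)
    ¬last last = Last[1+w]⇒¬First[w] (w + e) (subst Last (+-suc w e) last) first

  First-descends : ∀ t w → First (w + t * e) → First w
  First-descends zero    w first = subst First (+-identityʳ w) first
  First-descends (suc t) w first =
    First[w+e]⇒First[w] w (First-descends t (w + e) (subst First (sym (+-assoc w e (t * e))) first))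

  -- j + m stands for j - d modulo n.
  m : ℕ
  m = n ∸ d

  [j+m+d]%n≡j%n : ∀ j → (j + m + d) % n ≡ j % n
  [j+m+d]%n≡j%n j = begin
    (j + m + d) % n   ≡⟨ cong (_% n) (+-assoc j m d) ⟩
    (j + (m + d)) % n ≡⟨ cong (λ l → (j + l) % n) (trans (+-comm m d) (m+[n∸m]≡n (<⇒≤ d<n))) ⟩
    (j + n) % n       ≡⟨ [m+n]%n≡m%n j n ⟩
    j % n             ∎
    where open ≡-Reasoning

  Last⇒¬First[+m] : ∀ j → Last j → ¬ First (j + m)
  Last⇒¬First[+m] j last first =
    Last[1+w]⇒¬First[w] (j + n′) (Last-cong j≡j+n last)
      (First-descends n′ (j + n′) (First-cong j+m≡j+n′+n′e first))
    where
    -- j + n′ ≡ j - 1 and j + n′ + n′ e ≡ j - 1 - e = j - d ≡ j + m modulo n.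
    j≡j+n : j % n ≡ suc (j + n′) % n
    j≡j+n = sym (trans (cong (_% n) (sym (+-suc j n′))) ([m+n]%n≡m%n j n))
    j+m≡j+n′+n′e : (j + m) % n ≡ (j + n′ + n′ * e) % n
    j+m≡j+n′+n′e = %-cancelʳ-+ {j + m} {j + n′ + n′ * e} d (begin
      (j + m + d) % n           ≡⟨ [j+m+d]%n≡j%n j ⟩
      j % n                     ≡⟨ [m+kn]%n≡m%n j d n ⟨
      (j + d * n) % n           ≡⟨ cong (_% n) (wind j n′ e) ⟨
      (j + n′ + n′ * e + d) % n ∎)
      where
      open ≡-Reasoning
      wind : ∀ j n′ e → j + n′ + n′ * e + suc e ≡ j + suc e * suc n′
      wind = solve-∀

  ∅-interval : ∃[ F ] (IsFacet Γ F × τ F ⊆ ⊥ × ⊥ ⊆ F)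
  ∅-interval = interval ⊥ (cx (σ 0) ⊥ ⊥⊆ (proj₁ (σ-facet 0)))

  F₀ : Subset n
  F₀ = proj₁ ∅-interval

  F₀-facet : IsFacet Γ F₀
  F₀-facet = proj₁ (proj₂ ∅-interval)

  τF₀⊆⁅x⁆ : ∀ x → τ F₀ ⊆ ⁅ x ⁆
  τF₀⊆⁅x⁆ x y∈τF₀ = ⊥-elim (∉⊥ (proj₁ (proj₂ (proj₂ ∅-interval)) y∈τF₀))

  F₀-cases : ∀ j → v j ∈ F₀ → F₀ ≡ σ j ⊎ F₀ ≡ σ (j + m)
  F₀-cases j v∈F₀ with v (j + d) ∈? τ (σ j) | v (j + m) ∈? τ (σ (j + m))
  ... | no ¬last | _ =
    inj₁ (τ⊆⁅x⁆-unique F₀-facet (σ-facet j) v∈F₀ (v[k]∈σ[k] j) (τF₀⊆⁅x⁆ (v j)) (¬Last⇒τσ⊆⁅first⁆ j ¬last))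
  ... | yes _    | no ¬first =
    inj₂ (τ⊆⁅x⁆-unique F₀-facet (σ-facet (j + m)) v∈F₀
           (subst (_∈ σ (j + m)) v[j+m+d]≡v[j] (v∈σ (j + m) ≤-refl)) (τF₀⊆⁅x⁆ (v j))
           (subst (λ x → τ (σ (j + m)) ⊆ ⁅ x ⁆) v[j+m+d]≡v[j] (¬First⇒τσ⊆⁅last⁆ (j + m) ¬first)))
    where
    v[j+m+d]≡v[j] : v (j + m + d) ≡ v j
    v[j+m+d]≡v[j] = v-cong {j + m + d} {j} ([j+m+d]%n≡j%n j)
  ... | yes last | yes first = ⊥-elim (Last⇒¬First[+m] j last first)

  F₀≢σ : ∀ a → F₀ ≢ σ a
  F₀≢σ a F₀≡σ[a] =
    [ (λ F₀≡σ[1+a] → σ≢σ[1+] a (trans (sym F₀≡σ[a]) F₀≡σ[1+a]))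
    , (λ F₀≡σ[b] → σ-distinct b 0<e (≤-trans (n≤1+n e) (n≤1+n d))
                     (trans (sym F₀≡σ[b]) (trans F₀≡σ[a] (sym σ[b+e]≡σ[a])))) ]′
    (F₀-cases (suc a) (subst (v (suc a) ∈_) (sym F₀≡σ[a]) v[1+a]∈σ[a]))
    where
    b : ℕ
    b = suc a + m
    σ[b+e]≡σ[a] : σ (b + e) ≡ σ a
    σ[b+e]≡σ[a] = σ-cong {b + e} {a} (trans (cong (_% n) (regroup a m e)) ([j+m+d]%n≡j%n a))
      where
      regroup : ∀ a m e → suc a + m + e ≡ a + m + suc e
      regroup = solve-∀
    v[1+a]∈σ[a] : v (suc a) ∈ σ a
    v[1+a]∈σ[a] = subst (λ i → v i ∈ σ a) (+-comm a 1) (v∈σ a (s≤s z≤n))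

  F₀-has-no-vertex : ∀ x → x ∉ F₀
  F₀-has-no-vertex x x∈F₀ =
    [ F₀≢σ (toℕ x) , F₀≢σ (toℕ x + m) ]′ (F₀-cases (toℕ x) (subst (_∈ F₀) (sym (v-toℕ x)) x∈F₀))

  F₀≡σ[0] : F₀ ≡ σ 0
  F₀≡σ[0] = sym (proj₂ F₀-facet (σ 0) (proj₁ (σ-facet 0)) (⊥-elim ∘ F₀-has-no-vertex _))

proposition3p8 : (d n : ℕ) .{{_ : NonZero n}} → 2 ≤ d → (Γ : Family n) →
    IsSimplicialComplex Γ → IsDimensional d Γ →
    ((k : ℕ) → IsDFacet d Γ (arc n k (suc d))) →
    ((k : ℕ) → (τ : Subset n) → τ ⊆ arc n k (suc d) → ∣ τ ∣ ≡ d →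
       ((∃[ j ] (τ ≡ arc n j d)) → InExactlyTwoDFacets d Γ τ) ×
       (¬ (∃[ j ] (τ ≡ arc n j d)) → InExactlyOneDFacet d Γ τ)) →
    ¬ IsPartitionable Γ
proposition3p8 (suc (suc e)) (suc n′) (s≤s (s≤s z≤n)) Γ cx (dim , _) arc-facet ridges P = F₀≢σ 0 F₀≡σ[0]
  where open CyclicComplex cx dim arc-facet ridges z<s P
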